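{- Let $x,y\ge 1$ and let $i_1<\dots<i_x<j_1<\dots<j_y$ be positive integers forming a 2-partition. Put $\alpha=\lfloor (j_1-i_x)/2\rfloor+1$. If $\lambda(j_1)\ne\lambda(i_x)$, then \[F(f_{i_1}+\dots+f_{i_x}+f_{j_1}+\dots+f_{j_y};t)=F(f_{i_1}+\dots+f_{i_x};t)\,F(f_{j_1-i_x}+\dots+f_{j_y-i_x};t).\] If $\lambda(j_1)=\lambda(i_x)$, then \begin{multline*}F(f_{i_1}+\dots+f_{i_x}+f_{j_1}+\dots+f_{j_y};t)=F(f_{i_1}+\dots+f_{i_x};t)\,F(f_{j_1-i_x+1}+\dots+f_{j_y-i_x+1};t)\\-t^{\alpha+1}F(f_{i_1}+\dots+f_{i_{x-1}};t)\,F(f_{j_2-j_1+1}+\dots+f_{j_y-j_1+1};t),\end{multline*} where empty sums are $0$.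
   Context: Let $f_0=f_1=1$ and $f_i=f_{i-1}+f_{i-2}$ for $i\ge 2$. A Fibonacci partition of $n\in\mathbb{N}$ is a finite set $\{f_{i_1},\dots,f_{i_h}\}$ with $1\le i_1<\dots<i_h$ and $f_{i_1}+\dots+f_{i_h}=n$; $F_h(n)$ is the number of those with $h$ parts, and $F(n;t)=\sum_{h\ge0}F_h(n)t^h$ (so $F(0;t)=1$). A 2-partition is a finite set of integers $\{i_1<\dots<i_q\}$ with $i_1\ge1$ and consecutive differences at least $2$. For an integer $m$, $\lambda(m)=m\bmod 2\in\{0,1\}$. -}

module Defs where

open import Data.Nat using (ℕ; zero; suc; _+_; _∸_; _≤_; _≟_; _≤?_)
open import Data.Nat.ListAction using (sum)
open import Relation.Nullary using (yes; no)
open import Data.Nat.DivMod using (_%_; _/_)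
open import Data.Integer as ℤ using (ℤ)
open import Data.List using (List; []; _∷_; _++_; map; foldr; length; filter; upTo; concatMap)
open import Data.Product using (_×_)
open import Data.Unit using (⊤)
open import Relation.Nullary.Decidable using (_×-dec_)
open import Relation.Binary.PropositionalEquality using (_≡_)

fib : ℕ → ℕ
fib zero = 1
fib (suc zero) = 1
fib (suc (suc n)) = fib (suc n) + fib n

parity : ℕ → ℕ
parity m = m % 2

sublists : List ℕ → List (List ℕ)
sublists [] = [] ∷ []
sublists (a ∷ l) = map (a ∷_) (sublists l) ++ sublists l

oneTo : ℕ → List ℕ
oneTo n = map suc (upTo n)

-- F_h(n): number of sets of indices I ⊆ {1,2,...} with |I| = h and Σ_{i∈I} f_i = n.
-- Since f_i ≥ i for i ≥ 1, only indices in {1,...,n} can occur, so it suffices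
-- to range over subsets of {1,...,n}.  Distinct indices ≥ 1 give distinct
-- Fibonacci values, so index sets correspond bijectively to Fibonacci partitions.
Fh : ℕ → ℕ → ℕ
Fh h n = length (filter (λ s → (length s ≟ h) ×-dec (sum (map fib s) ≟ n)) (sublists (oneTo n)))

Poly : Set
Poly = ℕ → ℤ

F : ℕ → Poly
F n h = ℤ.+ (Fh h n)

_⊛_ : Poly → Poly → Poly
(p ⊛ q) h = foldr ℤ._+_ (ℤ.+ 0) (map (λ k → p k ℤ.* q (h ∸ k)) (upTo (suc h)))

_⊖_ : Poly → Poly → Poly
(p ⊖ q) h = p h ℤ.- q h

tpow* : ℕ → Poly → Poly
tpow* a p h with a ≤? h
... | yes _ = p (h ∸ a)
... | no _ = ℤ.+ 0

_≐_ : Poly → Poly → Set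
p ≐ q = ∀ h → p h ≡ q h

Gapped : List ℕ → Set
Gapped [] = ⊤
Gapped (a ∷ []) = ⊤
Gapped (a ∷ b ∷ l) = (a + 2 ≤ b) × Gapped (b ∷ l)

TwoPartition : List ℕ → Set
TwoPartition [] = ⊤
TwoPartition (a ∷ l) = (1 ≤ a) × Gapped (a ∷ l)

fibSum : List ℕ → ℕ
fibSum l = sum (map fib l)

-- Read a 2-partition index by index. If r is the Fibonacci sum of the indices read so far
-- and p the last of them, keep the pair (F(r), F_{<p}(r)), where F_{<p}(r) counts only the
-- partitions of r avoiding the part f_p. Appending an index s ≥ p + 2 transforms this pair
-- by a map that depends only on the gap s − p, since in a partition of f_s + r into parts
-- below f_s the part f_{s−1} is forced; and this map is linear over ℤ[t]. Hence F of the
-- whole sum is a fixed linear function of the state reached at i_x, entered through the gap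
-- j₁ − i_x, and the same function computes F of the translated indices j − i_x from the
-- state of the empty partition. For an odd gap the map ignores the second component, which
-- gives the product formula. For an even gap it adds t^((j₁ − i_x)/2 + 1) times the second
-- component F_{<i_x} = F(f_{i_1} + ⋯ + f_{i_x}) − t·F(f_{i_1} + ⋯ + f_{i_{x−1}}), which
-- produces the correction term.

module Submission where

open import Defs
open import Level using (0ℓ)
open import Data.Nat using (ℕ; zero; suc; _+_; _*_; _∸_; _≤_; _<_; z≤n; s≤s; s≤s⁻¹; _≟_; _≤?_)
open import Data.Nat.Properties
open import Data.Nat.ListAction using (sum)
open import Data.Nat.ListAction.Properties using (sum-++)
open import Data.Nat.DivMod using (_%_; _/_; [m+n]%n≡m%n; m*n/n≡m)
open import Data.List using (List; []; _∷_; _++_; _∷ʳ_; map; length; filter; upTo; foldr)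
open import Data.List.Properties using (length-++; filter-++; filter-none; filter-≐; map-++; upTo-∷ʳ)
open import Data.List.Relation.Unary.All using (universal)
open import Data.Product using (_×_; _,_; proj₁; proj₂)
open import Relation.Nullary using (Dec; yes; no; ¬_)
open import Relation.Nullary.Decidable using (_×-dec_)
open import Relation.Unary using (Pred; Decidable)
open import Relation.Binary.PropositionalEquality
open import Data.Empty using (⊥-elim)
open import Data.Unit using (⊤; tt)
open import Function using (_∘_)
open import Data.Integer as ℤ using (ℤ)
import Data.Integer.Properties as ℤP
open import Data.Integer.Tactic.RingSolver using (solve-∀)
open import Relation.Binary.Bundles using (Setoid)
import Relation.Binary.Reasoning.Setoid as SetoidReasoning
open import Algebra.Properties.CommutativeSemigroup +-commutativeSemigroup using (interchange)
open import Algebra.Properties.CommutativeSemigroup ℤP.+-commutativeSemigroup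
  using () renaming (interchange to ℤ-interchange; xy∙z≈xz∙y to ℤ-xy∙z≈xz∙y)

-- Counting partitions by size and Fibonacci sum

guard : {P : Set} → Dec P → ℕ → ℕ
guard (yes _) x = x
guard (no _)  _ = 0

withPart : ℕ → (ℕ → ℕ → ℕ) → ℕ → ℕ → ℕ
withPart a X zero    n = 0
withPart a X (suc h) n = guard (fib a ≤? n) (X h (n ∸ fib a))

count : List ℕ → ℕ → ℕ → ℕ
count []      zero    zero    = 1
count []      zero    (suc _) = 0
count []      (suc _) _       = 0
count (a ∷ l) h n = count l h n + withPart a (count l) h n

SizeAndSum : ℕ → ℕ → Pred (List ℕ) 0ℓ
SizeAndSum h n s = (length s ≡ h) × (fibSum s ≡ n)

sizeAndSum? : ∀ h n → Decidable (SizeAndSum h n)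
sizeAndSum? h n s = (length s ≟ h) ×-dec (fibSum s ≟ n)

length-filter-map : ∀ {P : Pred (List ℕ) 0ℓ} (P? : Decidable P) (f : List ℕ → List ℕ) xs →
                    length (filter P? (map f xs)) ≡ length (filter (λ x → P? (f x)) xs)
length-filter-map P? f [] = refl
length-filter-map P? f (x ∷ xs) with P? (f x)
... | yes _ = cong suc (length-filter-map P? f xs)
... | no  _ = length-filter-map P? f xs

length-filter-none : ∀ {P : Pred (List ℕ) 0ℓ} (P? : Decidable P) → (∀ x → ¬ P x) → ∀ xs →
                     length (filter P? xs) ≡ 0
length-filter-none P? ¬P xs = cong length (filter-none P? (universal ¬P xs))

sizeAndSum-∷⇒≤ : ∀ a s {h n} → SizeAndSum h n (a ∷ s) → fib a ≤ n
sizeAndSum-∷⇒≤ a s (_ , sum≡n) = subst (fib a ≤_) sum≡n (m≤m+n (fib a) _)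

sizeAndSum-∷⁻ : ∀ a s {h n} → SizeAndSum (suc h) n (a ∷ s) → SizeAndSum h (n ∸ fib a) s
sizeAndSum-∷⁻ a s (length≡ , sum≡n) =
  suc-injective length≡ , trans (sym (m+n∸m≡n (fib a) (fibSum s))) (cong (_∸ fib a) sum≡n)

sizeAndSum-∷⁺ : ∀ a s {h n} → fib a ≤ n → SizeAndSum h (n ∸ fib a) s → SizeAndSum (suc h) n (a ∷ s)
sizeAndSum-∷⁺ a s fa≤n (length≡ , sum≡) = cong suc length≡ , trans (cong (fib a +_) sum≡) (m+[n∸m]≡n fa≤n)

count-sublists : ∀ l h n → length (filter (sizeAndSum? h n) (sublists l)) ≡ count l h n
count-sublists []      zero    zero    = refl
count-sublists []      zero    (suc n) = refl
count-sublists []      (suc h) zero    = refl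
count-sublists []      (suc h) (suc n) = refl
count-sublists (a ∷ l) h n = begin
    length (filter P? (map (a ∷_) L ++ L))                    ≡⟨ cong length (filter-++ P? (map (a ∷_) L) L) ⟩
    length (filter P? (map (a ∷_) L) ++ filter P? L)          ≡⟨ length-++ (filter P? (map (a ∷_) L)) ⟩
    length (filter P? (map (a ∷_) L)) + length (filter P? L)  ≡⟨ cong₂ _+_ (trans (length-filter-map P? (a ∷_) L) (containing h))
                                                                             (count-sublists l h n) ⟩
    withPart a (count l) h n + count l h n                    ≡⟨ +-comm (withPart a (count l) h n) (count l h n) ⟩
    count l h n + withPart a (count l) h n                    ∎
  where
  open ≡-Reasoning
  L : List (List ℕ)
  L = sublists l
  P? : Decidable (SizeAndSum h n)
  P? = sizeAndSum? h n
  containing : ∀ h → length (filter (λ s → sizeAndSum? h n (a ∷ s)) L) ≡ withPart a (count l) h n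
  containing zero    = length-filter-none _ (λ { _ (() , _) }) L
  containing (suc h) with fib a ≤? n
  ... | no  fa≰n = length-filter-none (λ s → sizeAndSum? (suc h) n (a ∷ s)) (λ s → fa≰n ∘ sizeAndSum-∷⇒≤ a s) L
  ... | yes fa≤n = trans
    (cong length (filter-≐ (λ s → sizeAndSum? (suc h) n (a ∷ s)) (sizeAndSum? h (n ∸ fib a))
                           ((λ {s} → sizeAndSum-∷⁻ a s) , (λ {s} → sizeAndSum-∷⁺ a s fa≤n)) L))
    (count-sublists l h (n ∸ fib a))

Fh≡count : ∀ h n → Fh h n ≡ count (oneTo n) h n
Fh≡count h n = count-sublists (oneTo n) h n

guard-+ : {P : Set} (d : Dec P) (x y : ℕ) → guard d (x + y) ≡ guard d x + guard d y
guard-+ (yes _) x y = refl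
guard-+ (no _)  x y = refl

guard-0 : {P : Set} (d : Dec P) → guard d 0 ≡ 0
guard-0 (yes _) = refl
guard-0 (no _)  = refl

guard-yes : {P : Set} (d : Dec P) → P → ∀ x → guard d x ≡ x
guard-yes (yes _) _ x = refl
guard-yes (no ¬p) p x = ⊥-elim (¬p p)

guard-no : {P : Set} (d : Dec P) → ¬ P → ∀ x → guard d x ≡ 0
guard-no (yes p) ¬p x = ⊥-elim (¬p p)
guard-no (no _)  _  x = refl

guard-nested : ∀ a b n x → guard (a ≤? n) (guard (b ≤? n ∸ a) x) ≡ guard (a + b ≤? n) x
guard-nested a b n x with a ≤? n | b ≤? n ∸ a | a + b ≤? n
... | yes _   | yes _   | yes _   = refl
... | yes a≤n | yes b≤∸ | no a+b≰ = ⊥-elim (a+b≰ (subst (_≤ n) (+-comm b a) (m≤o∸n⇒m+n≤o b a≤n b≤∸)))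
... | yes _   | no b≰∸  | yes a+b≤ = ⊥-elim (b≰∸ (m+n≤o⇒m≤o∸n b (subst (_≤ n) (+-comm a b) a+b≤)))
... | yes _   | no _    | no _    = refl
... | no a≰n  | _       | yes a+b≤ = ⊥-elim (a≰n (m+n≤o⇒m≤o a a+b≤))
... | no _    | _       | no _    = refl

withPart-+ : ∀ a X Y h n → withPart a (λ h n → X h n + Y h n) h n ≡ withPart a X h n + withPart a Y h n
withPart-+ a X Y zero    n = refl
withPart-+ a X Y (suc h) n = guard-+ (fib a ≤? n) _ _

withPart-cong : ∀ a {X Y} → (∀ h n → X h n ≡ Y h n) → ∀ h n → withPart a X h n ≡ withPart a Y h n
withPart-cong a X≡Y zero    n = refl
withPart-cong a X≡Y (suc h) n = cong (guard (fib a ≤? n)) (X≡Y h (n ∸ fib a))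

withPart-comm : ∀ a b X h n → withPart a (withPart b X) h n ≡ withPart b (withPart a X) h n
withPart-comm a b X zero          n = refl
withPart-comm a b X (suc zero)    n = trans (guard-0 (fib a ≤? n)) (sym (guard-0 (fib b ≤? n)))
withPart-comm a b X (suc (suc h)) n = begin
    guard (fib a ≤? n) (guard (fib b ≤? n ∸ fib a) (X h (n ∸ fib a ∸ fib b)))
  ≡⟨ guard-nested (fib a) (fib b) n _ ⟩
    guard (fib a + fib b ≤? n) (X h (n ∸ fib a ∸ fib b))
  ≡⟨ cong (guard (fib a + fib b ≤? n) ∘ X h) (∸-+-assoc n (fib a) (fib b)) ⟩
    guard (fib a + fib b ≤? n) (X h (n ∸ (fib a + fib b)))
  ≡⟨ cong (λ m → guard (m ≤? n) (X h (n ∸ m))) (+-comm (fib a) (fib b)) ⟩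
    guard (fib b + fib a ≤? n) (X h (n ∸ (fib b + fib a)))
  ≡⟨ cong (guard (fib b + fib a ≤? n) ∘ X h) (∸-+-assoc n (fib b) (fib a)) ⟨
    guard (fib b + fib a ≤? n) (X h (n ∸ fib b ∸ fib a))
  ≡⟨ guard-nested (fib b) (fib a) n _ ⟨
    guard (fib b ≤? n) (guard (fib a ≤? n ∸ fib b) (X h (n ∸ fib b ∸ fib a))) ∎
  where open ≡-Reasoning

count-swap : ∀ a b l h n → count (a ∷ b ∷ l) h n ≡ count (b ∷ a ∷ l) h n
count-swap a b l h n = begin
    X h n + Wb h n + withPart a (λ h n → X h n + Wb h n) h n  ≡⟨ cong (X h n + Wb h n +_) (withPart-+ a X Wb h n) ⟩
    X h n + Wb h n + (Wa h n + withPart a Wb h n)             ≡⟨ cong (λ z → X h n + Wb h n + (Wa h n + z)) (withPart-comm a b X h n) ⟩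
    X h n + Wb h n + (Wa h n + withPart b Wa h n)             ≡⟨ interchange (X h n) (Wb h n) (Wa h n) (withPart b Wa h n) ⟩
    X h n + Wa h n + (Wb h n + withPart b Wa h n)             ≡⟨ cong (X h n + Wa h n +_) (withPart-+ b X Wa h n) ⟨
    X h n + Wa h n + withPart b (λ h n → X h n + Wa h n) h n  ∎
  where
  open ≡-Reasoning
  X Wa Wb : ℕ → ℕ → ℕ
  X  = count l
  Wa = withPart a X
  Wb = withPart b X

count-∷ʳ : ∀ a l h n → count (l ++ a ∷ []) h n ≡ count (a ∷ l) h n
count-∷ʳ a []      h n = refl
count-∷ʳ a (b ∷ l) h n =
  trans (cong₂ _+_ (count-∷ʳ a l h n) (withPart-cong b (count-∷ʳ a l) h n)) (count-swap b a l h n)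

count-oneTo-suc : ∀ k h n → count (oneTo (suc k)) h n ≡ count (oneTo k) h n + withPart (suc k) (count (oneTo k)) h n
count-oneTo-suc k h n = begin
    count (oneTo (suc k)) h n
  ≡⟨ cong (λ l → count (map suc l) h n) (upTo-∷ʳ k) ⟨
    count (map suc (upTo k ++ k ∷ [])) h n
  ≡⟨ cong (λ l → count l h n) (map-++ suc (upTo k) (k ∷ [])) ⟩
    count (oneTo k ++ suc k ∷ []) h n
  ≡⟨ count-∷ʳ (suc k) (oneTo k) h n ⟩
    count (oneTo k) h n + withPart (suc k) (count (oneTo k)) h n ∎
  where open ≡-Reasoning

fib-positive : ∀ n → 1 ≤ fib n
fib-positive zero          = s≤s z≤n
fib-positive (suc zero)    = s≤s z≤n
fib-positive (suc (suc n)) = ≤-trans (fib-positive (suc n)) (m≤m+n _ _)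

fib-≤-suc : ∀ n → fib n ≤ fib (suc n)
fib-≤-suc zero    = ≤-refl
fib-≤-suc (suc n) = m≤m+n _ _

fib-mono-≤ : ∀ {m n} → m ≤ n → fib m ≤ fib n
fib-mono-≤ {n = zero}  z≤n = ≤-refl
fib-mono-≤ {m} {suc n} m≤1+n with m ≟ suc n
... | yes refl = ≤-refl
... | no m≢1+n = ≤-trans (fib-mono-≤ (s≤s⁻¹ (≤∧≢⇒< m≤1+n m≢1+n))) (fib-≤-suc n)

n≤fib : ∀ n → n ≤ fib n
n≤fib zero          = z≤n
n≤fib (suc zero)    = s≤s z≤n
n≤fib (suc (suc n)) = subst (_≤ fib (suc n) + fib n) (+-comm (suc n) 1) (+-mono-≤ (n≤fib (suc n)) (fib-positive n))

-- Polynomials in t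

infixl 6 _⊕_
_⊕_ : Poly → Poly → Poly
(p ⊕ q) h = p h ℤ.+ q h

0P : Poly
0P _ = ℤ.+ 0

1P : Poly
1P zero    = ℤ.+ 1
1P (suc _) = ℤ.+ 0

shift : Poly → Poly
shift p zero    = ℤ.+ 0
shift p (suc h) = p h

shiftBy : ℕ → Poly → Poly
shiftBy zero    p = p
shiftBy (suc a) p = shift (shiftBy a p)

≐-setoid : Setoid 0ℓ 0ℓ
≐-setoid = record
  { Carrier       = Poly
  ; _≈_           = _≐_
  ; isEquivalence = record
    { refl  = λ _ → refl
    ; sym   = λ p≐q h → sym (p≐q h)
    ; trans = λ p≐q q≐r h → trans (p≐q h) (q≐r h)
    }
  }

open Setoid ≐-setoid using () renaming (refl to ≐-refl; sym to ≐-sym; trans to ≐-trans)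
module ≐-Reasoning = SetoidReasoning ≐-setoid

⊕-cong : ∀ {p p′ q q′} → p ≐ p′ → q ≐ q′ → (p ⊕ q) ≐ (p′ ⊕ q′)
⊕-cong p≐p′ q≐q′ h = cong₂ ℤ._+_ (p≐p′ h) (q≐q′ h)

⊕-congʳ : ∀ {p p′} q → p ≐ p′ → (p ⊕ q) ≐ (p′ ⊕ q)
⊕-congʳ q p≐p′ = ⊕-cong p≐p′ (λ h → refl {x = q h})

⊕-congˡ : ∀ p {q q′} → q ≐ q′ → (p ⊕ q) ≐ (p ⊕ q′)
⊕-congˡ p q≐q′ = ⊕-cong (λ h → refl {x = p h}) q≐q′

⊕-identityˡ : ∀ p → (0P ⊕ p) ≐ p
⊕-identityˡ p h = ℤP.+-identityˡ (p h)

⊕-interchange : ∀ p q r s → ((p ⊕ q) ⊕ (r ⊕ s)) ≐ ((p ⊕ r) ⊕ (q ⊕ s))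
⊕-interchange p q r s h = ℤ-interchange (p h) (q h) (r h) (s h)

⊕-swapʳ : ∀ p q r → ((p ⊕ q) ⊕ r) ≐ ((p ⊕ r) ⊕ q)
⊕-swapʳ p q r h = ℤ-xy∙z≈xz∙y (p h) (q h) (r h)

⊖-cong : ∀ {p p′ q q′} → p ≐ p′ → q ≐ q′ → (p ⊖ q) ≐ (p′ ⊖ q′)
⊖-cong p≐p′ q≐q′ h = cong₂ ℤ._-_ (p≐p′ h) (q≐q′ h)

⊕-⊖-cancel : ∀ p q z → (p ⊕ q) ≐ ((p ⊕ (q ⊕ z)) ⊖ z)
⊕-⊖-cancel p q z h = identity (p h) (q h) (z h)
  where
  identity : ∀ a b c → a ℤ.+ b ≡ (a ℤ.+ (b ℤ.+ c)) ℤ.- c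
  identity = solve-∀

shift-cong : ∀ {p q} → p ≐ q → shift p ≐ shift q
shift-cong p≐q zero    = refl
shift-cong p≐q (suc h) = p≐q h

shift-⊕ : ∀ p q → shift (p ⊕ q) ≐ (shift p ⊕ shift q)
shift-⊕ p q zero    = refl
shift-⊕ p q (suc h) = refl

shift-0 : shift 0P ≐ 0P
shift-0 zero    = refl
shift-0 (suc h) = refl

shift²-⊕ : ∀ p q → shift (shift (p ⊕ q)) ≐ (shift (shift p) ⊕ shift (shift q))
shift²-⊕ p q = ≐-trans (shift-cong (shift-⊕ p q)) (shift-⊕ (shift p) (shift q))

shift²-0 : shift (shift 0P) ≐ 0P
shift²-0 = ≐-trans (shift-cong shift-0) shift-0

0P-shift²-⊕ : ∀ p → (shift (shift 0P) ⊕ p) ≐ p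
0P-shift²-⊕ p = ≐-trans (⊕-congʳ p shift²-0) (⊕-identityˡ p)

tpow*≐shiftBy : ∀ a p → tpow* a p ≐ shiftBy a p
tpow*≐shiftBy a p h with a ≤? h
... | yes a≤h = sym (shiftBy-≤ a h a≤h)
  where
  shiftBy-≤ : ∀ a h → a ≤ h → shiftBy a p h ≡ p (h ∸ a)
  shiftBy-≤ zero    h       _         = refl
  shiftBy-≤ (suc a) (suc h) (s≤s a≤h) = shiftBy-≤ a h a≤h
... | no  a≰h = sym (shiftBy-< a h (≰⇒> a≰h))
  where
  shiftBy-< : ∀ a h → h < a → shiftBy a p h ≡ ℤ.+ 0
  shiftBy-< (suc a) zero    _         = refl
  shiftBy-< (suc a) (suc h) (s≤s h<a) = shiftBy-< a h h<a

sum< : ℕ → (ℕ → ℤ) → ℤ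
sum< zero    f = ℤ.+ 0
sum< (suc n) f = sum< n f ℤ.+ f n

foldr-+-∷ʳ : ∀ xs y → foldr ℤ._+_ (ℤ.+ 0) (xs ∷ʳ y) ≡ foldr ℤ._+_ (ℤ.+ 0) xs ℤ.+ y
foldr-+-∷ʳ []       y = trans (ℤP.+-identityʳ y) (sym (ℤP.+-identityˡ y))
foldr-+-∷ʳ (x ∷ xs) y = trans (cong (ℤ._+_ x) (foldr-+-∷ʳ xs y)) (sym (ℤP.+-assoc x _ y))

foldr-+-upTo : ∀ n f → foldr ℤ._+_ (ℤ.+ 0) (map f (upTo n)) ≡ sum< n f
foldr-+-upTo zero    f = refl
foldr-+-upTo (suc n) f = begin
    foldr ℤ._+_ (ℤ.+ 0) (map f (upTo (suc n)))   ≡⟨ cong (foldr ℤ._+_ (ℤ.+ 0) ∘ map f) (upTo-∷ʳ n) ⟨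
    foldr ℤ._+_ (ℤ.+ 0) (map f (upTo n ∷ʳ n))    ≡⟨ cong (foldr ℤ._+_ (ℤ.+ 0)) (map-++ f (upTo n) (n ∷ [])) ⟩
    foldr ℤ._+_ (ℤ.+ 0) (map f (upTo n) ∷ʳ f n)  ≡⟨ foldr-+-∷ʳ (map f (upTo n)) (f n) ⟩
    foldr ℤ._+_ (ℤ.+ 0) (map f (upTo n)) ℤ.+ f n ≡⟨ cong (ℤ._+ f n) (foldr-+-upTo n f) ⟩
    sum< n f ℤ.+ f n                             ∎
  where open ≡-Reasoning

sum<-cong : ∀ n {f g} → (∀ k → k < n → f k ≡ g k) → sum< n f ≡ sum< n g
sum<-cong zero    f≡g = refl
sum<-cong (suc n) f≡g = cong₂ ℤ._+_ (sum<-cong n (λ k k<n → f≡g k (m≤n⇒m≤1+n k<n))) (f≡g n ≤-refl)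

sum<-zero : ∀ n {f} → (∀ k → k < n → f k ≡ ℤ.+ 0) → sum< n f ≡ ℤ.+ 0
sum<-zero zero    f≡0 = refl
sum<-zero (suc n) f≡0 = cong₂ ℤ._+_ (sum<-zero n (λ k k<n → f≡0 k (m≤n⇒m≤1+n k<n))) (f≡0 n ≤-refl)

sum<-+ : ∀ n f g → sum< n (λ k → f k ℤ.+ g k) ≡ sum< n f ℤ.+ sum< n g
sum<-+ zero    f g = refl
sum<-+ (suc n) f g = trans (cong (ℤ._+ (f n ℤ.+ g n)) (sum<-+ n f g)) (ℤ-interchange (sum< n f) (sum< n g) (f n) (g n))

⊛-as-sum< : ∀ p q h → (p ⊛ q) h ≡ sum< (suc h) (λ k → p k ℤ.* q (h ∸ k))
⊛-as-sum< p q h = foldr-+-upTo (suc h) _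

⊛-congˡ : ∀ p {q q′} → q ≐ q′ → (p ⊛ q) ≐ (p ⊛ q′)
⊛-congˡ p {q} {q′} q≐q′ h = trans (⊛-as-sum< p q h)
  (trans (sum<-cong (suc h) (λ k _ → cong (p k ℤ.*_) (q≐q′ (h ∸ k)))) (sym (⊛-as-sum< p q′ h)))

⊛-congʳ : ∀ {p p′} q → p ≐ p′ → (p ⊛ q) ≐ (p′ ⊛ q)
⊛-congʳ {p} {p′} q p≐p′ h = trans (⊛-as-sum< p q h)
  (trans (sum<-cong (suc h) (λ k _ → cong (ℤ._* q (h ∸ k)) (p≐p′ k))) (sym (⊛-as-sum< p′ q h)))

⊛-distribˡ-⊕ : ∀ p q r → (p ⊛ (q ⊕ r)) ≐ ((p ⊛ q) ⊕ (p ⊛ r))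
⊛-distribˡ-⊕ p q r h = trans (⊛-as-sum< p (q ⊕ r) h)
  (trans (sum<-cong (suc h) (λ k _ → ℤP.*-distribˡ-+ (p k) (q (h ∸ k)) (r (h ∸ k))))
  (trans (sum<-+ (suc h) _ _) (sym (cong₂ ℤ._+_ (⊛-as-sum< p q h) (⊛-as-sum< p r h)))))

⊛-zeroʳ : ∀ p → (p ⊛ 0P) ≐ 0P
⊛-zeroʳ p h = trans (⊛-as-sum< p 0P h) (sum<-zero (suc h) (λ k _ → ℤP.*-zeroʳ (p k)))

⊛-shift : ∀ p q → (p ⊛ shift q) ≐ shift (p ⊛ q)
⊛-shift p q zero    = trans (ℤP.+-identityʳ _) (ℤP.*-zeroʳ (p 0))
⊛-shift p q (suc h) = begin
    (p ⊛ shift q) (suc h)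
  ≡⟨ ⊛-as-sum< p (shift q) (suc h) ⟩
    sum< (suc h) (λ k → p k ℤ.* shift q (suc h ∸ k)) ℤ.+ p (suc h) ℤ.* shift q (suc h ∸ suc h)
  ≡⟨ cong₂ ℤ._+_ (sum<-cong (suc h) (λ k k≤h → cong (λ i → p k ℤ.* shift q i) (+-∸-assoc 1 (s≤s⁻¹ k≤h))))
                 (trans (cong (λ i → p (suc h) ℤ.* shift q i) (n∸n≡0 h)) (ℤP.*-zeroʳ (p (suc h)))) ⟩
    sum< (suc h) (λ k → p k ℤ.* q (h ∸ k)) ℤ.+ ℤ.+ 0
  ≡⟨ ℤP.+-identityʳ _ ⟩
    sum< (suc h) (λ k → p k ℤ.* q (h ∸ k))
  ≡⟨ ⊛-as-sum< p q h ⟨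
    shift (p ⊛ q) (suc h) ∎
  where open ≡-Reasoning

⊛-identityʳ : ∀ p → (p ⊛ 1P) ≐ p
⊛-identityʳ p h = begin
    (p ⊛ 1P) h
  ≡⟨ ⊛-as-sum< p 1P h ⟩
    sum< h (λ k → p k ℤ.* 1P (h ∸ k)) ℤ.+ p h ℤ.* 1P (h ∸ h)
  ≡⟨ cong₂ ℤ._+_ (sum<-zero h (λ k k<h → trans (cong (p k ℤ.*_) (1P-∸ k<h)) (ℤP.*-zeroʳ (p k))))
                 (trans (cong (λ i → p h ℤ.* 1P i) (n∸n≡0 h)) (ℤP.*-identityʳ (p h))) ⟩
    ℤ.+ 0 ℤ.+ p h
  ≡⟨ ℤP.+-identityˡ (p h) ⟩
    p h ∎
  where
  open ≡-Reasoning
  1P-∸ : ∀ {k h} → k < h → 1P (h ∸ k) ≡ ℤ.+ 0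
  1P-∸ {zero}  {suc h} _         = refl
  1P-∸ {suc k} {suc h} (s≤s k<h) = 1P-∸ k<h

record Linear (T : Poly → Poly) : Set where
  field
    T-cong  : ∀ {p q} → p ≐ q → T p ≐ T q
    T-⊕     : ∀ p q → T (p ⊕ q) ≐ (T p ⊕ T q)
    T-shift : ∀ p → T (shift p) ≐ shift (T p)
    T-0     : T 0P ≐ 0P

id-linear : Linear (λ p → p)
id-linear = record { T-cong = λ p≐q → p≐q ; T-⊕ = λ _ _ → ≐-refl ; T-shift = λ _ → ≐-refl ; T-0 = ≐-refl }

shift-linear : Linear shift
shift-linear = record { T-cong = shift-cong ; T-⊕ = shift-⊕ ; T-shift = λ _ → ≐-refl ; T-0 = shift-0 }

∘-linear : ∀ {S T} → Linear S → Linear T → Linear (S ∘ T)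
∘-linear {S} {T} LS LT = record
  { T-cong  = S.T-cong ∘ T.T-cong
  ; T-⊕     = λ p q → ≐-trans (S.T-cong (T.T-⊕ p q)) (S.T-⊕ (T p) (T q))
  ; T-shift = λ p → ≐-trans (S.T-cong (T.T-shift p)) (S.T-shift (T p))
  ; T-0     = ≐-trans (S.T-cong T.T-0) S.T-0
  }
  where
  module S = Linear LS
  module T = Linear LT

shiftBy-linear : ∀ a → Linear (shiftBy a)
shiftBy-linear zero    = id-linear
shiftBy-linear (suc a) = ∘-linear shift-linear (shiftBy-linear a)

⊛-linear : ∀ p → Linear (p ⊛_)
⊛-linear p = record { T-cong = ⊛-congˡ p ; T-⊕ = ⊛-distribˡ-⊕ p ; T-shift = ⊛-shift p ; T-0 = ⊛-zeroʳ p }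

-- Partitions into the parts f₁, …, f_k

F≤ : ℕ → ℕ → Poly
F≤ k n h = ℤ.+ count (oneTo k) h n

F≐F≤ : ∀ n → F n ≐ F≤ n n
F≐F≤ n h = cong ℤ.+_ (Fh≡count h n)

F≤-zero-zero : F≤ 0 0 ≐ 1P
F≤-zero-zero zero    = refl
F≤-zero-zero (suc h) = refl

F≤-one-one : F≤ 1 1 ≐ shift 1P
F≤-one-one zero          = refl
F≤-one-one (suc zero)    = refl
F≤-one-one (suc (suc h)) = refl

F≤-zero-suc : ∀ n → F≤ 0 (suc n) ≐ 0P
F≤-zero-suc n zero    = refl
F≤-zero-suc n (suc h) = refl

F≤-suc-≤ : ∀ k n → fib (suc k) ≤ n → F≤ (suc k) n ≐ (F≤ k n ⊕ shift (F≤ k (n ∸ fib (suc k))))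
F≤-suc-≤ k n fits zero    = cong ℤ.+_ (count-oneTo-suc k zero n)
F≤-suc-≤ k n fits (suc h) = cong ℤ.+_ (trans (count-oneTo-suc k (suc h) n)
  (cong (count (oneTo k) (suc h) n +_) (guard-yes (fib (suc k) ≤? n) fits _)))

F≤-suc-< : ∀ k n → n < fib (suc k) → F≤ (suc k) n ≐ F≤ k n
F≤-suc-< k n exceeds h = cong ℤ.+_ (trans (count-oneTo-suc k h n)
  (trans (cong (count (oneTo k) h n +_) (unused h)) (+-identityʳ _)))
  where
  unused : ∀ h → withPart (suc k) (count (oneTo k)) h n ≡ 0
  unused zero    = refl
  unused (suc h) = guard-no (fib (suc k) ≤? n) (<⇒≱ exceeds) _

-- f₁ + ⋯ + f_k = f_{k+2} ∸ 2 bounds every partition into the parts f₁, …, f_k.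
F≤-beyond : ∀ k n → fib (suc (suc k)) < n + 2 → F≤ k n ≐ 0P
F≤-beyond zero    zero    (s≤s (s≤s ()))
F≤-beyond zero    (suc n) _   = F≤-zero-suc n
F≤-beyond (suc k) n       big with fib (suc k) ≤? n
... | no exceeds = ≐-trans (F≤-suc-< k n (≰⇒> exceeds)) (F≤-beyond k n big′)
  where
  big′ : fib (suc (suc k)) < n + 2
  big′ = ≤-<-trans (m≤m+n (fib (suc (suc k))) (fib (suc k))) big
... | yes fits = begin
    F≤ (suc k) n                             ≈⟨ F≤-suc-≤ k n fits ⟩
    F≤ k n ⊕ shift (F≤ k (n ∸ fib (suc k)))  ≈⟨ ⊕-cong (F≤-beyond k n big′) (shift-cong (F≤-beyond k _ big″)) ⟩
    0P ⊕ shift 0P                            ≈⟨ ⊕-identityˡ (shift 0P) ⟩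
    shift 0P                                 ≈⟨ shift-0 ⟩
    0P                                       ∎
  where
  open ≐-Reasoning
  big′ : fib (suc (suc k)) < n + 2
  big′ = ≤-<-trans (m≤m+n (fib (suc (suc k))) (fib (suc k))) big
  big″ : fib (suc (suc k)) < n ∸ fib (suc k) + 2
  big″ = subst₂ _≤_ (m+n∸n≡m (suc (fib (suc (suc k)))) (fib (suc k))) (+-∸-comm 2 fits)
                 (∸-monoˡ-≤ (fib (suc k)) big)

F≤-stable : ∀ {p k n} → n < fib (suc p) → p ≤ k → F≤ k n ≐ F≤ p n
F≤-stable {k = zero}      _  z≤n = ≐-refl
F≤-stable {p} {suc k} {n} lt p≤1+k with p ≟ suc k
... | yes refl   = ≐-refl
... | no  p≢1+k  = ≐-trans (F≤-suc-< k n (<-≤-trans lt (fib-mono-≤ (s≤s p≤k)))) (F≤-stable lt p≤k)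
  where
  p≤k : p ≤ k
  p≤k = s≤s⁻¹ (≤∧≢⇒< p≤1+k p≢1+k)

F≐F≤-stable : ∀ {p n} → n < fib (suc p) → p ≤ n → F n ≐ F≤ p n
F≐F≤-stable {n = n} lt p≤n = ≐-trans (F≐F≤ n) (F≤-stable lt p≤n)

F≤-top-forced : ∀ m n → fib (suc m) ≤ n → fib (suc (suc m)) < n + 2 →
                F≤ (suc m) n ≐ shift (F≤ m (n ∸ fib (suc m)))
F≤-top-forced m n fits big = begin
    F≤ (suc m) n                             ≈⟨ F≤-suc-≤ m n fits ⟩
    F≤ m n ⊕ shift (F≤ m (n ∸ fib (suc m)))  ≈⟨ ⊕-congʳ (shift (F≤ m (n ∸ fib (suc m)))) (F≤-beyond m n big) ⟩
    0P ⊕ shift (F≤ m (n ∸ fib (suc m)))      ≈⟨ ⊕-identityˡ _ ⟩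
    shift (F≤ m (n ∸ fib (suc m)))           ∎
  where open ≐-Reasoning

F≤-peel-fib : ∀ m r → F≤ (suc m) (fib (suc (suc m)) + r) ≐ shift (F≤ m (fib m + r))
F≤-peel-fib m r = ≐-trans (F≤-top-forced m n fits big) (shift-cong (λ h → cong (λ k → F≤ m k h) rest))
  where
  n : ℕ
  n = fib (suc (suc m)) + r
  fits : fib (suc m) ≤ n
  fits = ≤-trans (m≤m+n (fib (suc m)) (fib m)) (m≤m+n _ r)
  big : fib (suc (suc m)) < n + 2
  big = ≤-trans (s≤s (m≤m+n (fib (suc (suc m))) r)) (≤-trans (n≤1+n (suc n)) (≤-reflexive (+-comm 2 n)))
  rest : n ∸ fib (suc m) ≡ fib m + r
  rest = trans (cong (_∸ fib (suc m)) (+-assoc (fib (suc m)) (fib m) r)) (m+n∸m≡n (fib (suc m)) (fib m + r))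

F≤-peel-top : ∀ q r → fib q < r + 2 → F≤ (suc q) (fib (suc q) + r) ≐ shift (F≤ q r)
F≤-peel-top q r lt =
  ≐-trans (F≤-top-forced q n (m≤m+n _ r) big) (shift-cong (λ h → cong (λ k → F≤ q k h) (m+n∸m≡n (fib (suc q)) r)))
  where
  n : ℕ
  n = fib (suc q) + r
  big : fib (suc (suc q)) < n + 2
  big = subst (fib (suc q) + fib q <_) (sym (+-assoc (fib (suc q)) r 2)) (+-monoʳ-< (fib (suc q)) lt)

-- 2-partitions as chains of indices

-- The index 0 stands for the empty partition, which any index s ≥ 1 may follow.
Follows : ℕ → ℕ → Set
Follows zero    s = 1 ≤ s
Follows (suc p) s = 3 + p ≤ s

Chain : ℕ → List ℕ → Set
Chain p []      = ⊤
Chain p (s ∷ l) = Follows p s × Chain s l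

data FollowsView : ℕ → ℕ → Set where
  first : FollowsView 0 1
  jump  : ∀ e p → FollowsView p (suc (suc (e + p)))

follows-view : ∀ {p s} → Follows p s → FollowsView p s
follows-view {zero}  {suc zero}    _    = first
follows-view {zero}  {suc (suc s)} _    = subst (FollowsView 0) (cong (suc ∘ suc) (+-identityʳ s)) (jump s 0)
follows-view {suc p} {s}           3+p≤s = subst (FollowsView (suc p)) eq (jump (s ∸ (3 + p)) (suc p))
  where
  eq : suc (suc (s ∸ (3 + p) + suc p)) ≡ s
  eq = trans (cong suc (sym (+-suc (s ∸ (3 + p)) (suc p)))) (trans (sym (+-suc (s ∸ (3 + p)) (2 + p))) (m∸n+n≡m 3+p≤s))

follows-≤ : ∀ {p s} → Follows p s → p ≤ s
follows-≤ {zero}  _     = z≤n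
follows-≤ {suc p} 3+p≤s = ≤-trans (m≤n+m (suc p) 2) 3+p≤s

follows-positive : ∀ {p s} → Follows p s → 1 ≤ s
follows-positive {zero}  1≤s   = 1≤s
follows-positive {suc p} 3+p≤s = ≤-trans (s≤s z≤n) 3+p≤s

follows⇒+2≤ : ∀ {p s} → 1 ≤ p → Follows p s → p + 2 ≤ s
follows⇒+2≤ {suc p} {s} _ 3+p≤s = subst (_≤ s) (+-comm 2 (suc p)) 3+p≤s

+2≤⇒2≤∸ : ∀ {p s} → p + 2 ≤ s → 2 ≤ s ∸ p
+2≤⇒2≤∸ {p} {s} p+2≤s = subst (_≤ s ∸ p) (m+n∸m≡n p 2) (∸-monoˡ-≤ p p+2≤s)

follows⇒2≤∸ : ∀ {p s} → 1 ≤ p → Follows p s → 2 ≤ s ∸ p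
follows⇒2≤∸ 1≤p p⋖s = +2≤⇒2≤∸ (follows⇒+2≤ 1≤p p⋖s)

+2≤⇒follows : ∀ {p s} → p + 2 ≤ s → Follows p s
+2≤⇒follows {zero}  2≤s     = ≤-trans (s≤s z≤n) 2≤s
+2≤⇒follows {suc p} {s} p+2≤s = subst (_≤ s) (+-comm (suc p) 2) p+2≤s

gapped⇒chain : ∀ a l → 1 ≤ a → Gapped (a ∷ l) → Chain a l
gapped⇒chain a       []      _ _                = tt
gapped⇒chain (suc a) (b ∷ l) _ (a+2≤b , gapped) =
  +2≤⇒follows {suc a} a+2≤b , gapped⇒chain b l (≤-trans (s≤s z≤n) a+2≤b) gapped

twoPartition⇒chain : ∀ l → TwoPartition l → Chain 0 l
twoPartition⇒chain []      _              = tt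
twoPartition⇒chain (a ∷ l) (1≤a , gapped) = 1≤a , gapped⇒chain a l 1≤a gapped

lastOf : ℕ → List ℕ → ℕ
lastOf p []      = p
lastOf p (s ∷ l) = lastOf s l

chain-++ : ∀ p l m → Chain p (l ++ m) → Chain p l × Chain (lastOf p l) m
chain-++ p []      m chain          = tt , chain
chain-++ p (s ∷ l) m (p⋖s , chain) = (p⋖s , proj₁ (chain-++ s l m chain)) , proj₂ (chain-++ s l m chain)

fibSum-++ : ∀ l m → fibSum (l ++ m) ≡ fibSum l + fibSum m
fibSum-++ l m = trans (cong sum (map-++ fib l m)) (sum-++ (map fib l) (map fib m))

-- Reading a 2-partition index by index

State : Set
State = Poly × Poly

-- If A and B count the partitions of r into parts of index ≤ p, resp. < p, then
-- avoidTop (s ∸ p) A B counts those of f_s + r into parts of index < s; the recursion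
-- unfolds f_s = f_{s-1} + f_{s-2}, the part f_{s-1} being forced each time.
avoidTop : ℕ → Poly → Poly → Poly
avoidTop zero                       A B = 0P
avoidTop (suc zero)                 A B = 0P
avoidTop (suc (suc zero))           A B = shift (shift B)
avoidTop (suc (suc (suc zero)))     A B = shift (shift A)
avoidTop (suc (suc (suc (suc d))))  A B = shift (avoidTop (suc (suc d)) A B) ⊕ shift (shift A)

step : ℕ → State → State
step d (A , B) = avoidTop d A B ⊕ shift A , avoidTop d A B

run : ℕ → State → List ℕ → State
run p V []      = V
run p V (s ∷ l) = run s (step (s ∸ p) V) l

initial : State
initial = 1P , 0P

AvoidsTop : ℕ → ℕ → Poly → Set
AvoidsTop zero    r B = B ≐ 0P
AvoidsTop (suc q) r B = B ≐ F≤ q r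

-- The three bounds hold whenever r is the Fibonacci sum of a 2-partition with largest index p.
record Tracks (p r : ℕ) (V : State) : Set where
  field
    r<fib   : r < fib (suc p)
    p≤r     : p ≤ r
    fib≤1+r : fib p ≤ suc r
    all≐    : proj₁ V ≐ F≤ p r
    avoid≐  : AvoidsTop p r (proj₂ V)

F≐Tracks : ∀ {p r V} → Tracks p r V → F r ≐ proj₁ V
F≐Tracks t = ≐-trans (F≐F≤-stable r<fib p≤r) (≐-sym all≐)
  where open Tracks t

F≤-own-top : ∀ {p r V} → Tracks p r V → F≤ p (fib p + r) ≐ shift (proj₂ V)
F≤-own-top {zero}  {zero}  t = ≐-trans (F≤-zero-suc 0) (≐-trans (≐-sym shift-0) (shift-cong (≐-sym (Tracks.avoid≐ t))))
F≤-own-top {zero}  {suc r} t = ⊥-elim (<⇒≱ (Tracks.r<fib t) (s≤s z≤n))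
F≤-own-top {suc q} {r}     t = ≐-trans (F≤-peel-top q r fib<r+2) (shift-cong (≐-sym avoid≐))
  where
  open Tracks t
  fib<r+2 : fib q < r + 2
  fib<r+2 = ≤-trans (s≤s (fib-≤-suc q)) (≤-trans (s≤s fib≤1+r) (≤-reflexive (+-comm 2 r)))

module _ {p r : ℕ} {V : State} (t : Tracks p r V) where
  open Tracks t
  private
    A B : Poly
    A = proj₁ V
    B = proj₂ V

  avoid-correct : ∀ e → F≤ (suc (e + p)) (fib (suc (suc (e + p))) + r) ≐ avoidTop (suc (suc e)) A B
  all-correct : ∀ e → F≤ (suc (suc (e + p))) (fib (suc (suc (e + p))) + r) ≐ (avoidTop (suc (suc e)) A B ⊕ shift A)

  avoid-correct zero = ≐-trans (F≤-peel-fib p r) (shift-cong (F≤-own-top t))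
  avoid-correct (suc zero) =
    ≐-trans (F≤-peel-fib (suc p) r) (shift-cong (≐-trans (F≤-peel-top p r fib<r+2) (shift-cong (≐-sym all≐))))
    where
    fib<r+2 : fib p < r + 2
    fib<r+2 = ≤-trans (s≤s fib≤1+r) (≤-reflexive (+-comm 2 r))
  avoid-correct (suc (suc e)) =
    ≐-trans (F≤-peel-fib (suc (suc (e + p))) r) (≐-trans (shift-cong (all-correct e)) (shift-⊕ _ _))

  all-correct e = begin
      F≤ (suc m) (fib (suc m) + r)
        ≈⟨ F≤-suc-≤ m _ (m≤m+n _ r) ⟩
      F≤ m (fib (suc m) + r) ⊕ shift (F≤ m (fib (suc m) + r ∸ fib (suc m)))
        ≈⟨ ⊕-cong (avoid-correct e) (shift-cong (λ h → cong (λ k → F≤ m k h) (m+n∸m≡n (fib (suc m)) r))) ⟩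
      avoidTop (suc (suc e)) A B ⊕ shift (F≤ m r)
        ≈⟨ ⊕-congˡ (avoidTop (suc (suc e)) A B) (shift-cong (≐-trans (F≤-stable r<fib (m≤n+m p (suc e))) (≐-sym all≐))) ⟩
      avoidTop (suc (suc e)) A B ⊕ shift A
        ∎
    where
    open ≐-Reasoning
    m : ℕ
    m = suc (e + p)

tracks-step : ∀ {p r V s} → Tracks p r V → Follows p s → Tracks s (fib s + r) (step (s ∸ p) V)
tracks-step {p} {r} {V} t p⋖s with follows-view p⋖s
... | first with r
...   | suc _ = ⊥-elim (<⇒≱ (Tracks.r<fib t) (s≤s z≤n))
...   | zero  = record
  { r<fib = s≤s (s≤s z≤n) ; p≤r = s≤s z≤n ; fib≤1+r = s≤s z≤n
  ; all≐ = ≐-trans (⊕-identityˡ _) (≐-trans (shift-cong (≐-trans (Tracks.all≐ t) F≤-zero-zero)) (≐-sym F≤-one-one))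
  ; avoid≐ = ≐-sym (F≤-zero-suc 0) }
tracks-step {p} {r} {V} t p⋖s | jump e .p rewrite m+n∸n≡m (suc (suc e)) p = record
  { r<fib = +-monoʳ-< (fib (suc (suc (e + p)))) (<-≤-trans r<fib (fib-mono-≤ (s≤s (m≤n+m p e))))
  ; p≤r = ≤-trans (n≤fib _) (m≤m+n _ r)
  ; fib≤1+r = ≤-trans (m≤m+n _ r) (n≤1+n _)
  ; all≐ = ≐-sym (all-correct t e)
  ; avoid≐ = ≐-sym (avoid-correct t e) }
  where open Tracks t

tracks-initial : Tracks 0 0 initial
tracks-initial = record
  { r<fib = s≤s z≤n ; p≤r = z≤n ; fib≤1+r = s≤s z≤n ; all≐ = ≐-sym F≤-zero-zero ; avoid≐ = ≐-refl }

tracks-run : ∀ {p r V} l → Tracks p r V → Chain p l → Tracks (lastOf p l) (r + fibSum l) (run p V l)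
tracks-run {p} {r} {V} [] t _ = subst (λ n → Tracks p n V) (sym (+-identityʳ r)) t
tracks-run {p} {r} {V} (s ∷ l) t (p⋖s , chain) =
  subst (λ n → Tracks (lastOf s l) n (run s (step (s ∸ p) V) l)) eq (tracks-run l (tracks-step t p⋖s) chain)
  where
  eq : fib s + r + fibSum l ≡ r + (fib s + fibSum l)
  eq = trans (cong (_+ fibSum l) (+-comm (fib s) r)) (+-assoc r (fib s) (fibSum l))

-- Linearity of the recursion

infix 4 _≐₂_
_≐₂_ : State → State → Set
V ≐₂ W = (proj₁ V ≐ proj₁ W) × (proj₂ V ≐ proj₂ W)

≐₂-trans : ∀ {U V W} → U ≐₂ V → V ≐₂ W → U ≐₂ W
≐₂-trans (≐₁ , ≐₂) (≐₁′ , ≐₂′) = ≐-trans ≐₁ ≐₁′ , ≐-trans ≐₂ ≐₂′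

≐₂-sym : ∀ {V W} → V ≐₂ W → W ≐₂ V
≐₂-sym (≐₁ , ≐₂) = ≐-sym ≐₁ , ≐-sym ≐₂

infixl 6 _⊕₂_
_⊕₂_ : State → State → State
(A , B) ⊕₂ (A′ , B′) = A ⊕ A′ , B ⊕ B′

both : (Poly → Poly) → State → State
both T (A , B) = T A , T B

avoidTop-cong : ∀ d {A A′ B B′} → A ≐ A′ → B ≐ B′ → avoidTop d A B ≐ avoidTop d A′ B′
avoidTop-cong zero                      _    _    = ≐-refl
avoidTop-cong (suc zero)                _    _    = ≐-refl
avoidTop-cong (suc (suc zero))          _    B≐B′ = shift-cong (shift-cong B≐B′)
avoidTop-cong (suc (suc (suc zero)))    A≐A′ _    = shift-cong (shift-cong A≐A′)
avoidTop-cong (suc (suc (suc (suc d)))) A≐A′ B≐B′ =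
  ⊕-cong (shift-cong (avoidTop-cong (suc (suc d)) A≐A′ B≐B′)) (shift-cong (shift-cong A≐A′))

step-cong : ∀ d {V W} → V ≐₂ W → step d V ≐₂ step d W
step-cong d (A≐A′ , B≐B′) = ⊕-cong (avoidTop-cong d A≐A′ B≐B′) (shift-cong A≐A′) , avoidTop-cong d A≐A′ B≐B′

run-cong : ∀ p l {V W} → V ≐₂ W → run p V l ≐₂ run p W l
run-cong p []      V≐W = V≐W
run-cong p (s ∷ l) V≐W = run-cong s l (step-cong (s ∸ p) V≐W)

module _ {T : Poly → Poly} (L : Linear T) where
  open Linear L

  T-shift² : ∀ p → T (shift (shift p)) ≐ shift (shift (T p))
  T-shift² p = ≐-trans (T-shift (shift p)) (shift-cong (T-shift p))

  avoidTop-linear : ∀ d A B → T (avoidTop d A B) ≐ avoidTop d (T A) (T B)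
  avoidTop-linear zero                      A B = T-0
  avoidTop-linear (suc zero)                A B = T-0
  avoidTop-linear (suc (suc zero))          A B = T-shift² B
  avoidTop-linear (suc (suc (suc zero)))    A B = T-shift² A
  avoidTop-linear (suc (suc (suc (suc d)))) A B = ≐-trans (T-⊕ _ _)
    (⊕-cong (≐-trans (T-shift _) (shift-cong (avoidTop-linear (suc (suc d)) A B))) (T-shift² A))

  step-linear : ∀ d V → both T (step d V) ≐₂ step d (both T V)
  step-linear d V = ≐-trans (T-⊕ _ _) (⊕-cong (avoidTop-linear d _ _) (T-shift _)) , avoidTop-linear d _ _

  run-linear : ∀ p l V → both T (run p V l) ≐₂ run p (both T V) l
  run-linear p []      V = ≐-refl , ≐-refl
  run-linear p (s ∷ l) V = ≐₂-trans (run-linear s l (step (s ∸ p) V)) (run-cong s l (step-linear (s ∸ p) V))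

avoidTop-⊕ : ∀ d A A′ B B′ → avoidTop d (A ⊕ A′) (B ⊕ B′) ≐ (avoidTop d A B ⊕ avoidTop d A′ B′)
avoidTop-⊕ zero                      A A′ B B′ h = refl
avoidTop-⊕ (suc zero)                A A′ B B′ h = refl
avoidTop-⊕ (suc (suc zero))          A A′ B B′   = shift²-⊕ B B′
avoidTop-⊕ (suc (suc (suc zero)))    A A′ B B′   = shift²-⊕ A A′
avoidTop-⊕ (suc (suc (suc (suc d)))) A A′ B B′   =
  ≐-trans (⊕-cong (≐-trans (shift-cong (avoidTop-⊕ (suc (suc d)) A A′ B B′)) (shift-⊕ X X′)) (shift²-⊕ A A′))
          (⊕-interchange (shift X) (shift X′) (shift (shift A)) (shift (shift A′)))
  where
  X X′ : Poly
  X  = avoidTop (suc (suc d)) A B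
  X′ = avoidTop (suc (suc d)) A′ B′

step-⊕ : ∀ d V W → step d (V ⊕₂ W) ≐₂ (step d V ⊕₂ step d W)
step-⊕ d (A , B) (A′ , B′) =
  ≐-trans (⊕-cong (avoidTop-⊕ d A A′ B B′) (shift-⊕ A A′))
          (⊕-interchange (avoidTop d A B) (avoidTop d A′ B′) (shift A) (shift A′))
  , avoidTop-⊕ d A A′ B B′

run-⊕ : ∀ p l V W → run p (V ⊕₂ W) l ≐₂ (run p V l ⊕₂ run p W l)
run-⊕ p []      V W = ≐-refl , ≐-refl
run-⊕ p (s ∷ l) V W = ≐₂-trans (run-cong s l (step-⊕ (s ∸ p) V W)) (run-⊕ s l (step (s ∸ p) V) (step (s ∸ p) W))

step-⊛ : ∀ d A → step d (A , 0P) ≐₂ both (A ⊛_) (step d initial)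
step-⊛ d A =
  ≐₂-trans (step-cong d (≐-sym (⊛-identityʳ A) , ≐-sym (⊛-zeroʳ A))) (≐₂-sym (step-linear (⊛-linear A) d initial))

run-⊛ : ∀ p l d A → proj₁ (run p (step d (A , 0P)) l) ≐ (A ⊛ proj₁ (run p (step d initial) l))
run-⊛ p l d A =
  ≐-trans (proj₁ (run-cong p l (step-⊛ d A))) (≐-sym (proj₁ (run-linear (⊛-linear A) p l (step d initial))))

-- The parity of a gap

double : ℕ → ℕ
double zero    = zero
double (suc h) = suc (suc (double h))

data ParityView : ℕ → Set where
  even : ∀ h → ParityView (double h)
  odd  : ∀ h → ParityView (suc (double h))

parity-view : ∀ n → ParityView n
parity-view zero          = even 0
parity-view (suc zero)    = odd 0
parity-view (suc (suc n)) with parity-view n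
... | even h = even (suc h)
... | odd h  = odd (suc h)

parity-2+ : ∀ n → parity (2 + n) ≡ parity n
parity-2+ n = trans (cong (_% 2) (+-comm 2 n)) ([m+n]%n≡m%n n 2)

parity-double-+ : ∀ h a → parity (double h + a) ≡ parity a
parity-double-+ zero    a = refl
parity-double-+ (suc h) a = trans (parity-2+ (double h + a)) (parity-double-+ h a)

parity-suc : ∀ n → parity (suc n) ≢ parity n
parity-suc zero          ()
parity-suc (suc n) eq = parity-suc n (sym (trans (sym (parity-2+ n)) eq))

2+double/2 : ∀ h → (2 + double h) / 2 ≡ suc h
2+double/2 h = trans (cong (λ n → (2 + n) / 2) (double≡*2 h)) (m*n/n≡m (suc h) 2)
  where
  double≡*2 : ∀ h → double h ≡ h * 2
  double≡*2 zero    = refl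
  double≡*2 (suc h) = cong (suc ∘ suc) (double≡*2 h)

data GapView (i j : ℕ) : Set where
  even-gap : ∀ h → j ∸ i ≡ 2 + double h → parity j ≡ parity i → GapView i j
  odd-gap  : ∀ h → j ∸ i ≡ 3 + double h → parity j ≢ parity i → GapView i j

gap-view : ∀ {i j} → i + 2 ≤ j → GapView i j
gap-view {i} {j} i+2≤j = classify (parity-view (j ∸ i ∸ 2)) (sym (m+[n∸m]≡n (+2≤⇒2≤∸ i+2≤j)))
  where
  j≡ : ∀ {e} → j ∸ i ≡ e → j ≡ e + i
  j≡ gap = trans (sym (m∸n+n≡m (≤-trans (m≤m+n i 2) i+2≤j))) (cong (_+ i) gap)
  classify : ∀ {e} → ParityView e → j ∸ i ≡ 2 + e → GapView i j
  classify (even h) gap = even-gap h gap (trans (cong parity (j≡ gap)) (parity-double-+ (suc h) i))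
  classify (odd h)  gap = odd-gap h gap λ eq →
    parity-suc (double (suc h) + i) (trans (sym (cong parity (j≡ gap))) (trans eq (sym (parity-double-+ (suc h) i))))

avoidTop-odd : ∀ h A B → avoidTop (3 + double h) A B ≐ avoidTop (3 + double h) A 0P
avoidTop-odd zero    A B = ≐-refl
avoidTop-odd (suc h) A B = ⊕-congʳ (shift (shift A)) (shift-cong (avoidTop-odd h A B))

avoidTop-even : ∀ h A B → avoidTop (2 + double h) A B ≐ (avoidTop (2 + double h) A 0P ⊕ shiftBy (2 + h) B)
avoidTop-even zero    A B = ≐-sym (0P-shift²-⊕ (shift (shift B)))
avoidTop-even (suc h) A B = begin
    shift (avoidTop (2 + double h) A B) ⊕ shift (shift A)
  ≈⟨ ⊕-congʳ (shift (shift A)) (shift-cong (avoidTop-even h A B)) ⟩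
    shift (X ⊕ shiftBy (2 + h) B) ⊕ shift (shift A)
  ≈⟨ ⊕-congʳ (shift (shift A)) (shift-⊕ X (shiftBy (2 + h) B)) ⟩
    shift X ⊕ shiftBy (3 + h) B ⊕ shift (shift A)
  ≈⟨ ⊕-swapʳ (shift X) (shiftBy (3 + h) B) (shift (shift A)) ⟩
    shift X ⊕ shift (shift A) ⊕ shiftBy (3 + h) B ∎
  where
  open ≐-Reasoning
  X : Poly
  X = avoidTop (2 + double h) A 0P

avoidTop-suc : ∀ g A → avoidTop (3 + g) A 0P ≐ avoidTop (2 + g) A A
avoidTop-suc zero          A = ≐-refl
avoidTop-suc (suc zero)    A =
  ≐-trans (⊕-congʳ (shift (shift A)) (≐-trans (shift-cong shift²-0) shift-0)) (⊕-identityˡ (shift (shift A)))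
avoidTop-suc (suc (suc g)) A = ⊕-congʳ (shift (shift A)) (shift-cong (avoidTop-suc g A))

step-gap-≡ : ∀ {d d′} V → d ≡ d′ → step d V ≐₂ step d′ V
step-gap-≡ V refl = ≐-refl , ≐-refl

step-odd : ∀ h A B → step (3 + double h) (A , B) ≐₂ step (3 + double h) (A , 0P)
step-odd h A B = ⊕-congʳ (shift A) (avoidTop-odd h A B) , avoidTop-odd h A B

step-even : ∀ h A B → step (2 + double h) (A , B) ≐₂ (step (2 + double h) (A , 0P) ⊕₂ both (shiftBy (2 + h)) (B , B))
step-even h A B =
  ≐-trans (⊕-congʳ (shift A) (avoidTop-even h A B)) (⊕-swapʳ (avoidTop (2 + double h) A 0P) (shiftBy (2 + h) B) (shift A)) ,
  avoidTop-even h A B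

step-+1 : ∀ g A → 2 ≤ g → step (g + 1) (A , 0P) ≐₂ step g (A , A)
step-+1 (suc zero)    A (s≤s ())
step-+1 (suc (suc g)) A _ = ≐₂-trans (step-gap-≡ (A , 0P) (cong (suc ∘ suc) (+-comm g 1)))
  (⊕-congʳ (shift A) (avoidTop-suc g A) , avoidTop-suc g A)

-- Translating the indices

TranslationAbove : ℕ → (ℕ → ℕ) → Set
TranslationAbove c f = ∀ a b → c ≤ a → a ≤ b → f b ≡ (b ∸ a) + f a

∸-translation : ∀ c → TranslationAbove c (λ j → j ∸ c)
∸-translation c a b c≤a a≤b = trans (cong (_∸ c) (sym (m∸n+n≡m a≤b))) (+-∸-assoc (b ∸ a) c≤a)

∸+1-translation : ∀ c → TranslationAbove c (λ j → j ∸ c + 1)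
∸+1-translation c a b c≤a a≤b = trans (cong (_+ 1) (∸-translation c a b c≤a a≤b)) (+-assoc (b ∸ a) (a ∸ c) 1)

module _ {c : ℕ} {f : ℕ → ℕ} (translation : TranslationAbove c f) where

  run-translate : ∀ p V l → c ≤ p → Chain p l → run (f p) V (map f l) ≡ run p V l
  run-translate p V []      _   _               = refl
  run-translate p V (s ∷ l) c≤p (p⋖s , chain) = trans
    (cong (λ d → run (f s) (step d V) (map f l))
          (trans (cong (_∸ f p) (translation p s c≤p (follows-≤ p⋖s))) (m+n∸n≡m (s ∸ p) (f p))))
    (run-translate s (step (s ∸ p) V) l (≤-trans c≤p (follows-≤ p⋖s)) chain)

  chain-translate : ∀ p l → c ≤ p → 1 ≤ p → Chain p l → Chain (f p) (map f l)
  chain-translate p []      _   _   _               = tt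
  chain-translate p (s ∷ l) c≤p 1≤p (p⋖s , chain) =
    +2≤⇒follows (subst (f p + 2 ≤_) (sym (translation p s c≤p (follows-≤ p⋖s)))
                       (subst (_≤ (s ∸ p) + f p) (+-comm 2 (f p)) (+-monoˡ-≤ (f p) (follows⇒2≤∸ 1≤p p⋖s)))) ,
    chain-translate s l (≤-trans c≤p (follows-≤ p⋖s)) (follows-positive p⋖s) chain

  F-translate : ∀ p l → c ≤ p → 1 ≤ p → 1 ≤ f p → Chain p l →
                F (fibSum (map f (p ∷ l))) ≐ proj₁ (run p (step (f p) initial) l)
  F-translate p l c≤p 1≤p 1≤fp chain = ≐-trans
    (F≐Tracks (tracks-run (map f (p ∷ l)) tracks-initial (1≤fp , chain-translate p l c≤p 1≤p chain)))
    (cong-app (cong proj₁ (run-translate p (step (f p) initial) l c≤p chain)))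

F-relative : ∀ p l → 1 ≤ p → Chain p l → F (fibSum (map (λ j → j ∸ p + 1) l)) ≐ proj₁ (run p (1P , 1P) l)
F-relative p []      _   _               = F≐Tracks tracks-initial
F-relative p (s ∷ l) 1≤p (p⋖s , chain) = ≐-trans
  (F-translate (∸+1-translation p) s l (follows-≤ p⋖s) (follows-positive p⋖s) (m≤n+m 1 (s ∸ p)) chain)
  (proj₁ (run-cong s l (step-+1 (s ∸ p) 1P (follows⇒2≤∸ 1≤p p⋖s))))

-- Splitting at the gap j₁ − i_x

module Split (is' : List ℕ) (ix j1 : ℕ) (js' : List ℕ) (tp : TwoPartition (is' ++ ix ∷ j1 ∷ js')) where
  private
    q : ℕ
    q = lastOf 0 is'
    chains : Chain 0 is' × Chain q (ix ∷ j1 ∷ js')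
    chains = chain-++ 0 is' (ix ∷ j1 ∷ js') (twoPartition⇒chain _ tp)
    q⋖ix : Follows q ix
    q⋖ix = proj₁ (proj₂ chains)
    ix⋖j1 : Follows ix j1
    ix⋖j1 = proj₁ (proj₂ (proj₂ chains))
    chain-js : Chain j1 js'
    chain-js = proj₂ (proj₂ (proj₂ chains))
    1≤ix : 1 ≤ ix
    1≤ix = follows-positive q⋖ix
    ix≤j1 : ix ≤ j1
    ix≤j1 = follows-≤ ix⋖j1
    1≤j1 : 1 ≤ j1
    1≤j1 = follows-positive ix⋖j1

    V′ V : State
    V′ = run 0 initial is'
    V  = step (ix ∸ q) V′
    A′ A B : Poly
    A′ = proj₁ V′
    A  = proj₁ V
    B  = proj₂ V
    t′ : Tracks q (fibSum is') V′
    t′ = tracks-run is' tracks-initial (proj₁ chains)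
    t : Tracks ix (fib ix + fibSum is') V
    t = tracks-step t′ q⋖ix

    d : ℕ
    d = j1 ∸ ix

    tail : State → Poly
    tail W = proj₁ (run j1 W js')

    tail-cong : ∀ {W W′} → W ≐₂ W′ → tail W ≐ tail W′
    tail-cong W≐W′ = proj₁ (run-cong j1 js' W≐W′)

    tail-⊕ : ∀ W W′ → tail (W ⊕₂ W′) ≐ (tail W ⊕ tail W′)
    tail-⊕ W W′ = proj₁ (run-⊕ j1 js' W W′)

    tail-linear : ∀ {T} → Linear T → ∀ W → T (tail W) ≐ tail (both T W)
    tail-linear L W = proj₁ (run-linear L j1 js' W)

    fibSum-I : fibSum (is' ++ ix ∷ []) ≡ fib ix + fibSum is'
    fibSum-I = trans (fibSum-++ is' (ix ∷ [])) (trans (cong (fibSum is' +_) (+-identityʳ (fib ix))) (+-comm (fibSum is') (fib ix)))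

    F-I : F (fibSum (is' ++ ix ∷ [])) ≐ A
    F-I = ≐-trans (cong-app (cong F fibSum-I)) (F≐Tracks t)

    F-I′ : F (fibSum is') ≐ A′
    F-I′ = F≐Tracks t′

    F-IJ : F (fibSum (is' ++ ix ∷ []) + fibSum (j1 ∷ js')) ≐ tail (step d V)
    F-IJ = ≐-trans (cong-app (cong (λ n → F (n + fibSum (j1 ∷ js'))) fibSum-I))
                   (F≐Tracks (tracks-run (j1 ∷ js') t (ix⋖j1 , chain-js)))

    F-J : F (fibSum (map (λ j → j ∸ ix) (j1 ∷ js'))) ≐ tail (step d initial)
    F-J = F-translate (∸-translation ix) j1 js' ix≤j1 1≤j1 (≤-trans (s≤s z≤n) (follows⇒2≤∸ 1≤ix ix⋖j1)) chain-js

    F-J+1 : F (fibSum (map (λ j → j ∸ ix + 1) (j1 ∷ js'))) ≐ tail (step (d + 1) initial)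
    F-J+1 = F-translate (∸+1-translation ix) j1 js' ix≤j1 1≤j1 (m≤n+m 1 d) chain-js

    F-J′ : F (fibSum (map (λ j → j ∸ j1 + 1) js')) ≐ tail (1P , 1P)
    F-J′ = F-relative j1 js' 1≤j1 chain-js

    module Even (h : ℕ) (gap : d ≡ 2 + double h) where
      D k : ℕ
      D = 2 + double h
      k = 2 + h
      P Q Z : Poly
      P = tail (step D (A , 0P))
      Q = tail (both (shiftBy k) (B , B))
      Z = tail (both (shiftBy k) (shift A′ , shift A′))

      total : F (fibSum (is' ++ ix ∷ []) + fibSum (j1 ∷ js')) ≐ (P ⊕ Q)
      total = begin
        F (fibSum (is' ++ ix ∷ []) + fibSum (j1 ∷ js'))     ≈⟨ F-IJ ⟩
        tail (step d V)                                     ≈⟨ tail-cong (step-gap-≡ V gap) ⟩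
        tail (step D (A , B))                               ≈⟨ tail-cong (step-even h A B) ⟩
        tail (step D (A , 0P) ⊕₂ both (shiftBy k) (B , B))  ≈⟨ tail-⊕ (step D (A , 0P)) (both (shiftBy k) (B , B)) ⟩
        P ⊕ Q                                               ∎
        where open ≐-Reasoning

      -- A = B ⊕ shift A′ holds by the definition of step.
      product : (F (fibSum (is' ++ ix ∷ [])) ⊛ F (fibSum (map (λ j → j ∸ ix + 1) (j1 ∷ js')))) ≐ (P ⊕ (Q ⊕ Z))
      product = begin
        F (fibSum (is' ++ ix ∷ [])) ⊛ F (fibSum (map (λ j → j ∸ ix + 1) (j1 ∷ js')))
          ≈⟨ ≐-trans (⊛-congʳ _ F-I) (⊛-congˡ A F-J+1) ⟩
        A ⊛ tail (step (d + 1) initial)                     ≈⟨ run-⊛ j1 js' (d + 1) A ⟨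
        tail (step (d + 1) (A , 0P))                        ≈⟨ tail-cong (step-+1 d A (follows⇒2≤∸ 1≤ix ix⋖j1)) ⟩
        tail (step d (A , A))                               ≈⟨ tail-cong (step-gap-≡ (A , A) gap) ⟩
        tail (step D (A , A))                               ≈⟨ tail-cong (step-even h A A) ⟩
        tail (step D (A , 0P) ⊕₂ both (shiftBy k) (A , A))  ≈⟨ tail-⊕ (step D (A , 0P)) (both (shiftBy k) (A , A)) ⟩
        P ⊕ tail (both (shiftBy k) (A , A))                 ≈⟨ ⊕-congˡ P (tail-cong (T-⊕ B (shift A′) , T-⊕ B (shift A′))) ⟩
        P ⊕ tail (both (shiftBy k) (B , B) ⊕₂ both (shiftBy k) (shift A′ , shift A′))
          ≈⟨ ⊕-congˡ P (tail-⊕ (both (shiftBy k) (B , B)) (both (shiftBy k) (shift A′ , shift A′))) ⟩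
        P ⊕ (Q ⊕ Z)                                         ∎
        where
        open ≐-Reasoning
        open Linear (shiftBy-linear k)

      correction : tpow* (d / 2 + 1 + 1) (F (fibSum is') ⊛ F (fibSum (map (λ j → j ∸ j1 + 1) js'))) ≐ Z
      correction = begin
        tpow* (d / 2 + 1 + 1) (F (fibSum is') ⊛ F (fibSum (map (λ j → j ∸ j1 + 1) js')))
          ≈⟨ tpow*≐shiftBy (d / 2 + 1 + 1) _ ⟩
        shiftBy (d / 2 + 1 + 1) (F (fibSum is') ⊛ F (fibSum (map (λ j → j ∸ j1 + 1) js')))
          ≈⟨ cong-app (cong (λ a → shiftBy a (F (fibSum is') ⊛ F (fibSum (map (λ j → j ∸ j1 + 1) js')))) exponent) ⟩
        shiftBy (suc k) (F (fibSum is') ⊛ F (fibSum (map (λ j → j ∸ j1 + 1) js')))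
          ≈⟨ T-cong (≐-trans (⊛-congʳ _ F-I′) (⊛-congˡ A′ F-J′)) ⟩
        shiftBy (suc k) (A′ ⊛ tail (1P , 1P))               ≈⟨ T-cong (tail-linear (⊛-linear A′) (1P , 1P)) ⟩
        shiftBy (suc k) (tail (A′ ⊛ 1P , A′ ⊛ 1P))          ≈⟨ T-cong (tail-cong (⊛-identityʳ A′ , ⊛-identityʳ A′)) ⟩
        shiftBy (suc k) (tail (A′ , A′))                    ≈⟨ tail-linear (shiftBy-linear (suc k)) (A′ , A′) ⟩
        tail (both (shiftBy (suc k)) (A′ , A′))             ≈⟨ tail-cong (Tₖ-shift A′ , Tₖ-shift A′) ⟨
        Z                                                   ∎
        where
        open ≐-Reasoning
        open Linear (shiftBy-linear (suc k)) using (T-cong)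
        open Linear (shiftBy-linear k) using () renaming (T-shift to Tₖ-shift)
        exponent : d / 2 + 1 + 1 ≡ suc k
        exponent = trans (cong (λ n → n / 2 + 1 + 1) gap)
                         (trans (cong (λ n → n + 1 + 1) (2+double/2 h)) (trans (+-assoc (suc h) 1 1) (+-comm (suc h) 2)))

  split-odd : parity j1 ≢ parity ix →
    F (fibSum (is' ++ ix ∷ []) + fibSum (j1 ∷ js'))
      ≐ (F (fibSum (is' ++ ix ∷ [])) ⊛ F (fibSum (map (λ j → j ∸ ix) (j1 ∷ js'))))
  split-odd ≢ with gap-view (follows⇒+2≤ 1≤ix ix⋖j1)
  ... | even-gap _ _ ≡ = ⊥-elim (≢ ≡)
  ... | odd-gap h gap _ = begin
      F (fibSum (is' ++ ix ∷ []) + fibSum (j1 ∷ js'))  ≈⟨ F-IJ ⟩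
      tail (step d V)                                  ≈⟨ tail-cong (step-gap-≡ V gap) ⟩
      tail (step (3 + double h) (A , B))               ≈⟨ tail-cong (step-odd h A B) ⟩
      tail (step (3 + double h) (A , 0P))              ≈⟨ run-⊛ j1 js' (3 + double h) A ⟩
      A ⊛ tail (step (3 + double h) initial)           ≈⟨ ⊛-congˡ A (tail-cong (step-gap-≡ initial (sym gap))) ⟩
      A ⊛ tail (step d initial)                        ≈⟨ ⊛-congˡ A (≐-sym F-J) ⟩
      A ⊛ F (fibSum (map (λ j → j ∸ ix) (j1 ∷ js')))   ≈⟨ ⊛-congʳ _ (≐-sym F-I) ⟩
      F (fibSum (is' ++ ix ∷ [])) ⊛ F (fibSum (map (λ j → j ∸ ix) (j1 ∷ js'))) ∎
    where open ≐-Reasoning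

  split-even : parity j1 ≡ parity ix →
    F (fibSum (is' ++ ix ∷ []) + fibSum (j1 ∷ js'))
      ≐ ((F (fibSum (is' ++ ix ∷ [])) ⊛ F (fibSum (map (λ j → j ∸ ix + 1) (j1 ∷ js'))))
         ⊖ tpow* ((j1 ∸ ix) / 2 + 1 + 1) (F (fibSum is') ⊛ F (fibSum (map (λ j → j ∸ j1 + 1) js'))))
  split-even ≡ with gap-view (follows⇒+2≤ 1≤ix ix⋖j1)
  ... | odd-gap _ _ ≢ = ⊥-elim (≢ ≡)
  ... | even-gap h gap _ =
    ≐-trans total (≐-trans (⊕-⊖-cancel P Q Z) (⊖-cong (≐-sym product) (≐-sym correction)))
    where open Even h gap

lemma1p7 : (is' : List ℕ) (ix : ℕ) (j1 : ℕ) (js' : List ℕ) →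
    TwoPartition (is' ++ ix ∷ j1 ∷ js') →
    ((parity j1 ≢ parity ix) →
      F (fibSum (is' ++ ix ∷ []) + fibSum (j1 ∷ js'))
        ≐ (F (fibSum (is' ++ ix ∷ [])) ⊛ F (fibSum (map (λ j → j ∸ ix) (j1 ∷ js'))))) ×
    ((parity j1 ≡ parity ix) →
      F (fibSum (is' ++ ix ∷ []) + fibSum (j1 ∷ js'))
        ≐ ((F (fibSum (is' ++ ix ∷ [])) ⊛ F (fibSum (map (λ j → j ∸ ix + 1) (j1 ∷ js'))))
           ⊖ tpow* ((j1 ∸ ix) / 2 + 1 + 1) (F (fibSum is') ⊛ F (fibSum (map (λ j → j ∸ j1 + 1) js')))))
lemma1p7 is' ix j1 js' tp = split-odd , split-even
  where open Split is' ix j1 js' tp
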